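{- Let $G=(V,E)$ be a graph. Assume that removing the edges $u'u''$ and $v'v''$ from $G$ breaks it into two graphs $G'=(V',E')$ and $G''=(V'',E'')$ with $u',v'\in V'$ and $u'',v''\in V''$, such that: (1) $u'v'\in E$ and $u''v''\notin E$; (2) there is a spanning Eulerian subgraph $T'$ of $G'$ with at most $\frac{4}{3}|V'|-2$ edges; (3) there is a spanning Eulerian subgraph $T''$ of $G''\cup u''v''$ (the graph $G''$ with the edge $u''v''$ added) with at most $\frac{4}{3}|V''|-2$ edges. Then there is a spanning Eulerian subgraph $T$ of $G$ with at most $\frac{4}{3}|V|-2$ edges.
   Context: A spanning Eulerian subgraph of a graph $H$ is a connected multigraph on the full vertex set of $H$ whose edges are copies of edges of $H$ (multiple copies of an edge allowed) and in which every vertex has even degree. -}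

module Defs where

open import Data.Nat using (ℕ; zero; suc; _+_; _*_; _≤_)
open import Data.Nat.Divisibility using (_∣_)
open import Data.Fin using (Fin; _≟_)
open import Data.Fin.Subset using (Subset; _∈_; _∉_; ∁)
open import Data.List using (List; []; _∷_; length)
open import Data.List.Membership.Propositional renaming (_∈_ to _∈ˡ_)
open import Data.List.Relation.Unary.All using (All)
open import Data.Product using (_×_; _,_)
open import Data.Sum using (_⊎_)
open import Relation.Nullary using (¬_; yes; no)
open import Relation.Binary.PropositionalEquality using (_≡_)

record SimpleGraph (n : ℕ) : Set₁ where
  field
    Adj   : Fin n → Fin n → Set
    sym   : ∀ {x y} → Adj x y → Adj y x
    irrefl : ∀ {x} → ¬ Adj x x
open SimpleGraph public

-- A multigraph on Fin n: a list of edges (each listed once per copy).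
Multigraph : ℕ → Set
Multigraph n = List (Fin n × Fin n)

-- Contribution of an edge to the degree of v (a loop would count twice).
endpoints : ∀ {n} → Fin n → Fin n × Fin n → ℕ
endpoints v (a , b) = ind a + ind b
  where
  ind : _ → ℕ
  ind x with v ≟ x
  ... | yes _ = 1
  ... | no  _ = 0

degree : ∀ {n} → Multigraph n → Fin n → ℕ
degree []       v = 0
degree (e ∷ es) v = endpoints v e + degree es v

data Reachable {n} (T : Multigraph n) : Fin n → Fin n → Set where
  here  : ∀ {x} → Reachable T x x
  stepF : ∀ {x y z} → (x , y) ∈ˡ T → Reachable T y z → Reachable T x z
  stepB : ∀ {x y z} → (y , x) ∈ˡ T → Reachable T y z → Reachable T x z

record SpanningEulerian {n} (V : Subset n) (E : Fin n → Fin n → Set)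
                        (T : Multigraph n) : Set where
  field
    edgesOK   : All (λ { (a , b) → E a b × a ∈ V × b ∈ V }) T
    evenDeg   : ∀ v → v ∈ V → 2 ∣ degree T v
    connected : ∀ x y → x ∈ V → y ∈ V → Reachable T x y

Induced : ∀ {n} → SimpleGraph n → Subset n → Fin n → Fin n → Set
Induced G W x y = Adj G x y × x ∈ W × y ∈ W

AddEdge : ∀ {n} → (Fin n → Fin n → Set) → Fin n → Fin n → Fin n → Fin n → Set
AddEdge E a b x y = E x y ⊎ ((x ≡ a × y ≡ b) ⊎ (x ≡ b × y ≡ a))

module Submission where

-- Let k be the number of copies of the virtual edge u″v″ in T″. Deleting them
-- leaves T″ with odd degree at u″ and v″ exactly when k is odd, and splits it
-- into at most two pieces, containing u″ and v″. Together with T′, these are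
-- repaired in G by k + 2 or fewer real edges: two copies of u′u″ if k = 0, the
-- path u″u′v′v″ if k is odd, and two copies each of u′u″ and v′v″ if k ≥ 2 is
-- even. The resulting T has at most |T′| + |T″| + 2 edges, and
-- (4/3 |V′| − 2) + (4/3 |V″| − 2) + 2 ≤ 4/3 |V| − 2.

open import Defs hiding (sym)
open import Data.Nat using (ℕ; zero; suc; _+_; _*_; _≤_; s≤s; z≤n)
open import Data.Nat.Properties hiding (_≟_)
open import Data.Nat.Divisibility using (_∣_; divides; m∣m*n; ∣m+n∣m⇒∣n; ∣m∣n⇒∣m+n)
open import Data.Nat.Tactic.RingSolver using (solve-∀)
open import Data.Fin using (Fin; _≟_)
open import Data.Fin.Subset using (Subset; _∈_; _∉_; ∁; ∣_∣; ⊤)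
open import Data.Fin.Subset.Properties
  using (∈⊤; _∈?_; x∈∁p⇒x∉p; x∉p⇒x∈∁p; ∣p∣≤n; ∣∁p∣≡n∸∣p∣)
open import Data.List using ([]; _∷_; length; _++_)
open import Data.List.Properties using (length-++)
open import Data.List.Membership.Propositional using () renaming (_∈_ to _∈ˡ_)
open import Data.List.Membership.Propositional.Properties using (∈-++⁺ˡ; ∈-++⁺ʳ)
open import Data.List.Relation.Unary.Any using (here; there)
open import Data.List.Relation.Unary.All as All using (All; []; _∷_)
open import Data.List.Relation.Unary.All.Properties using (++⁺)
open import Data.Product using (Σ; ∃-syntax; _×_; _,_; proj₁; proj₂)
open import Data.Product.Properties using (≡-dec)
open import Data.Sum using (_⊎_; inj₁; inj₂; map; map₁)
open import Data.Empty using (⊥-elim)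
open import Relation.Nullary using (¬_; Dec; yes; no)
open import Relation.Nullary.Decidable using (_⊎-dec_)
open import Relation.Binary.PropositionalEquality

indicator : ∀ {n} → Fin n → Fin n → ℕ
indicator v x with v ≟ x
... | yes _ = 1
... | no  _ = 0

indicator-≢ : ∀ {n} {v x : Fin n} → v ≢ x → indicator v x ≡ 0
indicator-≢ {v = v} {x} v≢x with v ≟ x
... | yes v≡x = ⊥-elim (v≢x v≡x)
... | no  _   = refl

endpoints≡indicator : ∀ {n} (v x y : Fin n) →
                      endpoints v (x , y) ≡ indicator v x + indicator v y
endpoints≡indicator v x y with v ≟ x | v ≟ y
... | yes _ | yes _ = refl
... | yes _ | no  _ = refl
... | no  _ | yes _ = refl
... | no  _ | no  _ = refl

endpoints-≢ : ∀ {n} {v x y : Fin n} → v ≢ x → v ≢ y → endpoints v (x , y) ≡ 0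
endpoints-≢ {v = v} {x} {y} v≢x v≢y = begin
  endpoints v (x , y)            ≡⟨ endpoints≡indicator v x y ⟩
  indicator v x + indicator v y  ≡⟨ cong₂ _+_ (indicator-≢ v≢x) (indicator-≢ v≢y) ⟩
  0                              ∎
  where open ≡-Reasoning

degree-++ : ∀ {n} (S T : Multigraph n) v → degree (S ++ T) v ≡ degree S v + degree T v
degree-++ []      T v = refl
degree-++ (e ∷ S) T v =
  trans (cong (endpoints v e +_) (degree-++ S T v)) (sym (+-assoc (endpoints v e) _ _))

degree-avoided : ∀ {n} (T : Multigraph n) v →
                 All (λ e → v ≢ proj₁ e × v ≢ proj₂ e) T → degree T v ≡ 0
degree-avoided []             v []                = refl
degree-avoided ((x , y) ∷ T) v ((v≢x , v≢y) ∷ a) =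
  cong₂ _+_ (endpoints-≢ v≢x v≢y) (degree-avoided T v a)

Reachable-mono : ∀ {n} {S T : Multigraph n} → (∀ {e} → e ∈ˡ S → e ∈ˡ T) →
                 ∀ {x y} → Reachable S x y → Reachable T x y
Reachable-mono S⊆T here        = here
Reachable-mono S⊆T (stepF e p) = stepF (S⊆T e) (Reachable-mono S⊆T p)
Reachable-mono S⊆T (stepB e p) = stepB (S⊆T e) (Reachable-mono S⊆T p)

Reachable-trans : ∀ {n} {T : Multigraph n} {x y z} →
                  Reachable T x y → Reachable T y z → Reachable T x z
Reachable-trans here        q = q
Reachable-trans (stepF e p) q = stepF e (Reachable-trans p q)
Reachable-trans (stepB e p) q = stepB e (Reachable-trans p q)

Reachable-sym : ∀ {n} {T : Multigraph n} {x y} → Reachable T x y → Reachable T y x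
Reachable-sym here        = here
Reachable-sym (stepF e p) = Reachable-trans (Reachable-sym p) (stepB e here)
Reachable-sym (stepB e p) = Reachable-trans (Reachable-sym p) (stepF e here)

∣p∣+∣∁p∣≡n : ∀ {n} (p : Subset n) → ∣ p ∣ + ∣ ∁ p ∣ ≡ n
∣p∣+∣∁p∣≡n p = trans (cong (∣ p ∣ +_) (∣∁p∣≡n∸∣p∣ p)) (m+[n∸m]≡n (∣p∣≤n p))

parity : ∀ k → ∃[ m ] (k ≡ m + m ⊎ k ≡ suc (m + m))
parity zero = 0 , inj₁ refl
parity (suc k) with parity k
... | m , inj₁ k≡m+m   = m , inj₂ (cong suc k≡m+m)
... | m , inj₂ k≡1+m+m = suc m , inj₁ (cong suc (trans k≡1+m+m (sym (+-suc m m))))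

2∣m+k⇒2∣n+k⇒2∣m+n : ∀ {m n} k → 2 ∣ m + k → 2 ∣ n + k → 2 ∣ m + n
2∣m+k⇒2∣n+k⇒2∣m+n {m} {n} k 2∣m+k 2∣n+k =
  ∣m+n∣m⇒∣n (subst (2 ∣_) (regroup m n k) (∣m∣n⇒∣m+n 2∣m+k 2∣n+k)) (m∣m*n k)
  where
  regroup : ∀ m n k → (m + k) + (n + k) ≡ 2 * k + (m + n)
  regroup = solve-∀

-- t = |T′|, r + k = |T″|, and x counts the real edges replacing the k virtual ones.
glued-bound : ∀ x t r k P Q → x ≤ k + 2 → 3 * t + 6 ≤ 4 * P → 3 * (r + k) + 6 ≤ 4 * Q →
              3 * (x + (t + r)) + 6 ≤ 4 * (P + Q)
glued-bound x t r k P Q x≤k+2 t-bound rk-bound = begin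
  3 * (x + (t + r)) + 6            ≤⟨ +-monoˡ-≤ 6 (*-monoʳ-≤ 3 (+-monoˡ-≤ (t + r) x≤k+2)) ⟩
  3 * ((k + 2) + (t + r)) + 6      ≡⟨ regroup t r k ⟩
  (3 * t + 6) + (3 * (r + k) + 6)  ≤⟨ +-mono-≤ t-bound rk-bound ⟩
  4 * P + 4 * Q                    ≡⟨ sym (*-distribˡ-+ 4 P Q) ⟩
  4 * (P + Q)                      ∎
  where
  open ≤-Reasoning
  regroup : ∀ t r k → 3 * ((k + 2) + (t + r)) + 6 ≡ (3 * t + 6) + (3 * (r + k) + 6)
  regroup = solve-∀

module EdgeRemoval {n} (a b : Fin n) where

  IsEdge : Fin n × Fin n → Set
  IsEdge e = e ≡ (a , b) ⊎ e ≡ (b , a)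

  isEdge? : ∀ e → Dec (IsEdge e)
  isEdge? e = ≡-dec _≟_ _≟_ e (a , b) ⊎-dec ≡-dec _≟_ _≟_ e (b , a)

  without : Multigraph n → Multigraph n
  without []      = []
  without (e ∷ T) with isEdge? e
  ... | yes _ = without T
  ... | no  _ = e ∷ without T

  multiplicity : Multigraph n → ℕ
  multiplicity []      = 0
  multiplicity (e ∷ T) with isEdge? e
  ... | yes _ = suc (multiplicity T)
  ... | no  _ = multiplicity T

  length-without : ∀ T → length T ≡ length (without T) + multiplicity T
  length-without []      = refl
  length-without (e ∷ T) with isEdge? e
  ... | yes _ = trans (cong suc (length-without T)) (sym (+-suc _ _))
  ... | no  _ = cong suc (length-without T)

  endpoints-IsEdge : ∀ {e} v → IsEdge e → endpoints v e ≡ endpoints v (a , b)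
  endpoints-IsEdge v (inj₁ refl) = refl
  endpoints-IsEdge v (inj₂ refl) = begin
    endpoints v (b , a)            ≡⟨ endpoints≡indicator v b a ⟩
    indicator v b + indicator v a  ≡⟨ +-comm (indicator v b) (indicator v a) ⟩
    indicator v a + indicator v b  ≡⟨ endpoints≡indicator v a b ⟨
    endpoints v (a , b)            ∎
    where open ≡-Reasoning

  degree-without : ∀ T v →
    degree T v ≡ degree (without T) v + multiplicity T * endpoints v (a , b)
  degree-without []      v = refl
  degree-without (e ∷ T) v with isEdge? e
  ... | yes e-ab rewrite endpoints-IsEdge v e-ab | degree-without T v =
    regroup (endpoints v (a , b)) (degree (without T) v) (multiplicity T * endpoints v (a , b))
    where
    regroup : ∀ x y z → x + (y + z) ≡ y + (x + z)
    regroup = solve-∀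
  ... | no  _ rewrite degree-without T v = sym (+-assoc (endpoints v e) _ _)

  ∈-without : ∀ {T e} → e ∈ˡ T → e ∈ˡ without T ⊎ IsEdge e
  ∈-without {e′ ∷ T} (here refl) with isEdge? e′
  ... | yes e-ab = inj₂ e-ab
  ... | no  _    = inj₁ (here refl)
  ∈-without {e′ ∷ T} (there e∈T) with isEdge? e′
  ... | yes _ = ∈-without e∈T
  ... | no  _ = map₁ there (∈-without e∈T)

  without-idle : ∀ T → multiplicity T ≡ 0 → without T ≡ T
  without-idle []      _ = refl
  without-idle (e ∷ T) m≡0 with isEdge? e
  ... | yes _ = ⊥-elim (1+n≢0 m≡0)
  ... | no  _ = cong (e ∷_) (without-idle T m≡0)

  All-without : ∀ {P : Fin n × Fin n → Set} {T} →
                All P T → All (λ e → P e × ¬ IsEdge e) (without T)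
  All-without []                = []
  All-without {T = e ∷ T} (p ∷ ps) with isEdge? e
  ... | yes _    = All-without ps
  ... | no  ¬e-ab = (p , ¬e-ab) ∷ All-without ps

  -- A walk to a either avoids the edge ab, or its part after the last use of ab
  -- is a walk to a or b that avoids it.
  Reachable-without : ∀ {T x} → Reachable T x a →
                      Reachable (without T) x a ⊎ Reachable (without T) x b
  Reachable-without here = inj₁ here
  Reachable-without (stepF e∈T p) with ∈-without e∈T
  ... | inj₁ e∈T- = map (stepF e∈T-) (stepF e∈T-) (Reachable-without p)
  ... | inj₂ (inj₁ refl) = inj₁ here
  ... | inj₂ (inj₂ refl) = inj₂ here
  Reachable-without (stepB e∈T p) with ∈-without e∈T
  ... | inj₁ e∈T- = map (stepB e∈T-) (stepB e∈T-) (Reachable-without p)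
  ... | inj₂ (inj₁ refl) = inj₂ here
  ... | inj₂ (inj₂ refl) = inj₁ here

module Gluing {n} (G : SimpleGraph n) (V′ : Subset n) (u′ v′ u″ v″ : Fin n)
  (u′∈V′ : u′ ∈ V′) (v′∈V′ : v′ ∈ V′) (u″∉V′ : u″ ∈ ∁ V′) (v″∉V′ : v″ ∈ ∁ V′)
  (u′u″ : Adj G u′ u″) (v′v″ : Adj G v′ v″) (u′v′ : Adj G u′ v′)
  {T′ T″ : Multigraph n}
  (T′-eulerian : SpanningEulerian V′ (Induced G V′) T′)
  (T′-bound : 3 * length T′ + 6 ≤ 4 * ∣ V′ ∣)
  (T″-eulerian : SpanningEulerian (∁ V′) (AddEdge (Induced G (∁ V′)) u″ v″) T″)
  (T″-bound : 3 * length T″ + 6 ≤ 4 * ∣ ∁ V′ ∣) where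

  open EdgeRemoval u″ v″
  module T′ = SpanningEulerian T′-eulerian
  module T″ = SpanningEulerian T″-eulerian

  R : Multigraph n
  R = without T″

  k : ℕ
  k = multiplicity T″

  Result : Set
  Result = Σ (Multigraph n) λ T → SpanningEulerian ⊤ (Adj G) T × 3 * length T + 6 ≤ 4 * n

  InG : Fin n × Fin n → Set
  InG (x , y) = Adj G x y

  inside≢outside : ∀ {x y} → x ∈ V′ → y ∈ ∁ V′ → x ≢ y
  inside≢outside x∈V′ y∉V′ refl = x∈∁p⇒x∉p y∉V′ x∈V′

  R-in-G : All InG R
  R-in-G = All.map real (All-without T″.edgesOK)
    where
    real : ∀ {e} → _ → InG e
    real ((inj₁ (xy , _) , _) , _)                 = xy
    real ((inj₂ (inj₁ (refl , refl)) , _) , ¬e-ab) = ⊥-elim (¬e-ab (inj₁ refl))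
    real ((inj₂ (inj₂ (refl , refl)) , _) , ¬e-ab) = ⊥-elim (¬e-ab (inj₂ refl))

  T′-in-G : All InG T′
  T′-in-G = All.map (λ { ((xy , _) , _) → xy }) T′.edgesOK

  degree-R-inside : ∀ v → v ∈ V′ → degree R v ≡ 0
  degree-R-inside v v∈V′ = degree-avoided R v (All.map avoids (All-without T″.edgesOK))
    where
    avoids : ∀ {e} → _ → v ≢ proj₁ e × v ≢ proj₂ e
    avoids ((_ , x∉V′ , y∉V′) , _) = inside≢outside v∈V′ x∉V′ , inside≢outside v∈V′ y∉V′

  degree-T′-outside : ∀ v → v ∉ V′ → degree T′ v ≡ 0
  degree-T′-outside v v∉V′ = degree-avoided T′ v (All.map avoids T′.edgesOK)
    where
    avoids : ∀ {e} → _ → v ≢ proj₁ e × v ≢ proj₂ e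
    avoids (_ , x∈V′ , y∈V′) = (λ { refl → v∉V′ x∈V′ }) , (λ { refl → v∉V′ y∈V′ })

  Reachable-outside : ∀ x → x ∉ V′ → Reachable R x u″ ⊎ Reachable R x v″
  Reachable-outside x x∉V′ = Reachable-without (T″.connected x u″ (x∉p⇒x∈∁p x∉V′) u″∉V′)

  module Glued (extra : Multigraph n) where

    T : Multigraph n
    T = extra ++ (T′ ++ R)

    T′⊆T : ∀ {e} → e ∈ˡ T′ → e ∈ˡ T
    T′⊆T e∈T′ = ∈-++⁺ʳ extra (∈-++⁺ˡ e∈T′)

    R⊆T : ∀ {e} → e ∈ˡ R → e ∈ˡ T
    R⊆T e∈R = ∈-++⁺ʳ extra (∈-++⁺ʳ T′ e∈R)

    Reachable-inside : ∀ x → x ∈ V′ → Reachable T x u′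
    Reachable-inside x x∈V′ = Reachable-mono T′⊆T (T′.connected x u′ x∈V′ u′∈V′)

    degree-T : ∀ v → degree T v ≡ degree extra v + (degree T′ v + degree R v)
    degree-T v = trans (degree-++ extra _ v) (cong (degree extra v +_) (degree-++ T′ R v))

    length-T : length T ≡ length extra + (length T′ + length R)
    length-T = trans (length-++ extra) (cong (length extra +_) (length-++ T′))

    -- The parity hypothesis says that extra has the same degrees as k copies of
    -- u″v″, modulo 2.
    glue : All InG extra →
      (∀ v → 2 ∣ degree extra v + k * endpoints v (u″ , v″)) → length extra ≤ k + 2 →
      Reachable T u″ u′ → Reachable T v″ u′ → Result
    glue extra-in-G extra-parity extra-length u″↝u′ v″↝u′ = T , eulerian , bound
      where
      even-inside : ∀ v → v ∈ V′ → 2 ∣ degree T v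
      even-inside v v∈V′ = subst (2 ∣_) (sym degree≡) (∣m∣n⇒∣m+n even-extra (T′.evenDeg v v∈V′))
        where
        no-virtual : endpoints v (u″ , v″) ≡ 0
        no-virtual = endpoints-≢ (inside≢outside v∈V′ u″∉V′) (inside≢outside v∈V′ v″∉V′)
        even-extra : 2 ∣ degree extra v
        even-extra = subst (2 ∣_)
          (trans (cong (λ j → degree extra v + k * j) no-virtual)
                 (trans (cong (degree extra v +_) (*-zeroʳ k)) (+-identityʳ _)))
          (extra-parity v)
        degree≡ : degree T v ≡ degree extra v + degree T′ v
        degree≡ = trans (degree-T v)
          (cong (degree extra v +_) (trans (cong (degree T′ v +_) (degree-R-inside v v∈V′))
                                           (+-identityʳ _)))

      even-outside : ∀ v → v ∉ V′ → 2 ∣ degree T v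
      even-outside v v∉V′ = subst (2 ∣_) (sym degree≡)
        (2∣m+k⇒2∣n+k⇒2∣m+n (k * endpoints v (u″ , v″)) (extra-parity v)
          (subst (2 ∣_) (degree-without T″ v) (T″.evenDeg v (x∉p⇒x∈∁p v∉V′))))
        where
        degree≡ : degree T v ≡ degree extra v + degree R v
        degree≡ = trans (degree-T v) (cong (λ d → degree extra v + (d + degree R v))
                                           (degree-T′-outside v v∉V′))

      Reachable-T : ∀ x → Reachable T x u′
      Reachable-T x with x ∈? V′
      ... | yes x∈V′ = Reachable-inside x x∈V′
      ... | no  x∉V′ with Reachable-outside x x∉V′
      ... | inj₁ x↝u″ = Reachable-trans (Reachable-mono R⊆T x↝u″) u″↝u′
      ... | inj₂ x↝v″ = Reachable-trans (Reachable-mono R⊆T x↝v″) v″↝u′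

      eulerian : SpanningEulerian ⊤ (Adj G) T
      eulerian = record
        { edgesOK   = All.map (λ xy → xy , ∈⊤ , ∈⊤) (++⁺ extra-in-G (++⁺ T′-in-G R-in-G))
        ; evenDeg   = λ v _ → even v
        ; connected = λ x y _ _ → Reachable-trans (Reachable-T x) (Reachable-sym (Reachable-T y))
        }
        where
        even : ∀ v → 2 ∣ degree T v
        even v with v ∈? V′
        ... | yes v∈V′ = even-inside v v∈V′
        ... | no  v∉V′ = even-outside v v∉V′

      bound : 3 * length T + 6 ≤ 4 * n
      bound = subst₂ (λ t m → 3 * t + 6 ≤ 4 * m) (sym length-T) (∣p∣+∣∁p∣≡n V′)
        (glued-bound (length extra) (length T′) (length R) k ∣ V′ ∣ ∣ ∁ V′ ∣ extra-length
          T′-bound (subst (λ t → 3 * t + 6 ≤ 4 * ∣ ∁ V′ ∣) (length-without T″) T″-bound))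

  unused-virtual-edge : k ≡ 0 → Result
  unused-virtual-edge k≡0 =
    glue (u′u″ ∷ u′u″ ∷ []) parity-ok (m≤n+m 2 k) (stepB (here refl) here)
         (Reachable-trans (Reachable-mono R⊆T v″↝u″) (stepB (here refl) here))
    where
    extra : Multigraph n
    extra = (u′ , u″) ∷ (u′ , u″) ∷ []
    open Glued extra
    parity-ok : ∀ v → 2 ∣ degree extra v + k * endpoints v (u″ , v″)
    parity-ok v rewrite k≡0 = divides (endpoints v (u′ , u″)) (doubled (endpoints v (u′ , u″)))
      where
      doubled : ∀ d → d + (d + 0) + 0 ≡ d * 2
      doubled = solve-∀
    v″↝u″ : Reachable R v″ u″
    v″↝u″ = subst (λ S → Reachable S v″ u″) (sym (without-idle T″ k≡0))
                  (T″.connected v″ u″ v″∉V′ u″∉V′)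

  odd-virtual-edge : ∀ m → k ≡ suc (m + m) → Result
  odd-virtual-edge m k≡ =
    glue (u′u″ ∷ u′v′ ∷ v′v″ ∷ []) parity-ok
         (subst (λ j → 3 ≤ j + 2) (sym k≡) (+-monoˡ-≤ 2 (s≤s z≤n)))
         (stepB (here refl) here)
         (stepB (there (there (here refl))) (stepB (there (here refl)) here))
    where
    extra : Multigraph n
    extra = (u′ , u″) ∷ (u′ , v′) ∷ (v′ , v″) ∷ []
    open Glued extra
    parity-ok : ∀ v → 2 ∣ degree extra v + k * endpoints v (u″ , v″)
    parity-ok v
      rewrite k≡ | endpoints≡indicator v u′ u″ | endpoints≡indicator v u′ v′
            | endpoints≡indicator v v′ v″ | endpoints≡indicator v u″ v″ =
      divides (indicator v u′ + indicator v v′ + suc m * (indicator v u″ + indicator v v″))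
              (path (indicator v u′) (indicator v u″) (indicator v v′) (indicator v v″) m)
      where
      path : ∀ a b c d m → (a + b) + ((a + c) + ((c + d) + 0)) + suc (m + m) * (b + d)
                           ≡ (a + c + suc m * (b + d)) * 2
      path = solve-∀

  even-virtual-edge : ∀ m → k ≡ suc m + suc m → Result
  even-virtual-edge m k≡ =
    glue (u′u″ ∷ u′u″ ∷ v′v″ ∷ v′v″ ∷ []) parity-ok
         (subst (λ j → 4 ≤ j + 2) (sym k≡)
                (+-monoˡ-≤ 2 (s≤s (≤-trans (s≤s z≤n) (m≤n+m (suc m) m)))))
         (stepB (here refl) here)
         (stepB (there (there (here refl))) (Reachable-inside v′ v′∈V′))
    where
    extra : Multigraph n
    extra = (u′ , u″) ∷ (u′ , u″) ∷ (v′ , v″) ∷ (v′ , v″) ∷ []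
    open Glued extra
    parity-ok : ∀ v → 2 ∣ degree extra v + k * endpoints v (u″ , v″)
    parity-ok v rewrite k≡ =
      divides (a + b + suc m * c) (doubled a b c m)
      where
      a b c : ℕ
      a = endpoints v (u′ , u″)
      b = endpoints v (v′ , v″)
      c = endpoints v (u″ , v″)
      doubled : ∀ a b c m → a + (a + (b + (b + 0))) + (suc m + suc m) * c
                            ≡ (a + b + suc m * c) * 2
      doubled = solve-∀

  result : Result
  result with parity k
  ... | zero  , inj₁ k≡0 = unused-virtual-edge k≡0
  ... | suc m , inj₁ k≡  = even-virtual-edge m k≡
  ... | m     , inj₂ k≡  = odd-virtual-edge m k≡

lemma3 : ∀ {n} (G : SimpleGraph n) (V′ : Subset n) (u′ v′ u″ v″ : Fin n) →
    u′ ∈ V′ → v′ ∈ V′ → u″ ∈ ∁ V′ → v″ ∈ ∁ V′ →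
    Adj G u′ u″ → Adj G v′ v″ →
    (∀ x y → x ∈ V′ → y ∈ ∁ V′ → Adj G x y →
      (x ≡ u′ × y ≡ u″) ⊎ (x ≡ v′ × y ≡ v″)) →
    Adj G u′ v′ → ¬ Adj G u″ v″ → ¬ u″ ≡ v″ →
    (Σ (Multigraph n) λ T′ → SpanningEulerian V′ (Induced G V′) T′ ×
      3 * length T′ + 6 ≤ 4 * ∣ V′ ∣) →
    (Σ (Multigraph n) λ T″ →
      SpanningEulerian (∁ V′) (AddEdge (Induced G (∁ V′)) u″ v″) T″ ×
      3 * length T″ + 6 ≤ 4 * ∣ ∁ V′ ∣) →
    Σ (Multigraph n) λ T → SpanningEulerian ⊤ (Adj G) T ×
      3 * length T + 6 ≤ 4 * n
lemma3 G V′ u′ v′ u″ v″ u′∈V′ v′∈V′ u″∉V′ v″∉V′ u′u″ v′v″ _ u′v′ _ _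
       (T′ , T′-eulerian , T′-bound) (T″ , T″-eulerian , T″-bound) =
  Gluing.result G V′ u′ v′ u″ v″ u′∈V′ v′∈V′ u″∉V′ v″∉V′ u′u″ v′v″ u′v′
                T′-eulerian T′-bound T″-eulerian T″-bound
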